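{- Let $n,k,r$ be positive integers with $r\ge 2$, and let $A_i,B_i$ ($i=1,\dots,r$) be $k$-element segments (sets of consecutive integers) of $[n]$ such that $A_i\cap B_i=\emptyset$ for each $i$ and $A_1\cap\bigcup_{i=2}^r(A_i\cup B_i)=\emptyset$. Let $\Pi$ be a uniformly random permutation of $[n]$, and for each $i$ let $\mathcal{E}_i$ be the event that the subsequences of $\Pi$ on the positions in $A_i$ and on the positions in $B_i$ are similar (i.e. the pair $(A_i,B_i)$ induces block twins in $\Pi$). Then \[ {\mathds P}(\mathcal{E}_1\cap\cdots\cap\mathcal{E}_r)={\mathds P}(\mathcal{E}_1)\,{\mathds P}(\mathcal{E}_2\cap\cdots\cap\mathcal{E}_r). \]
   Context: Two sequences of distinct integers $(x_1,\dots,x_k)$ and $(y_1,\dots,y_k)$ are similar if $x_i<x_j \iff y_i<y_j$ for all $1\le i<j\le k$. For a set of positions $A=\{a_1<\dots<a_k\}$, the subsequence of $\Pi$ on $A$ is $(\Pi(a_1),\dots,\Pi(a_k))$. -}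

module Defs where

open import Data.Nat as ℕ using (ℕ; zero; suc; _+_; _*_)
import Data.Nat.Properties as ℕP
open import Data.Fin as Fin using (Fin; toℕ; fromℕ<)
open import Data.Fin.Properties using (all?; _≟_; _<?_; toℕ<n)
open import Data.Vec using (Vec; []; _∷_; lookup)
open import Data.List using (List; []; _∷_; [_]; map; concatMap; allFin; filter; length)
open import Data.Product using (_×_; _,_; proj₁; proj₂)
open import Function.Bundles using (_⇔_; mk⇔; Equivalence)
open import Relation.Nullary using (Dec; ¬_; yes; no)
open import Relation.Nullary.Decidable using (_×-dec_; _→-dec_; ¬?; map′)
open import Relation.Binary.PropositionalEquality using (_≡_; _≢_)

-- Positions of [n] are modelled 0-indexed as Fin n.
-- A k-element segment of [n]: {s, s+1, ..., s+k-1} with s + k ≤ n.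
record Seg (n k : ℕ) : Set where
  constructor seg
  field
    start : ℕ
    fits  : start + k ℕ.≤ n

pos : ∀ {n k} → Seg n k → Fin k → Fin n
pos {n} {k} S j = fromℕ< {Seg.start S + toℕ j} (ℕP.<-≤-trans (ℕP.+-monoʳ-< (Seg.start S) (toℕ<n j)) (Seg.fits S))

Disjoint : ∀ {n k} → Seg n k → Seg n k → Set
Disjoint S T = ∀ j j' → pos S j ≢ pos T j'

-- permutations of [n], as vectors (Π(1), ..., Π(n)) with Π injective (hence bijective)
IsPerm : ∀ {n} → Vec (Fin n) n → Set
IsPerm {n} v = ∀ (i j : Fin n) → lookup v i ≡ lookup v j → i ≡ j

isPerm? : ∀ {n} (v : Vec (Fin n) n) → Dec (IsPerm v)
isPerm? v = all? λ i → all? λ j → (lookup v i ≟ lookup v j) →-dec (i ≟ j)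

Similar : ∀ {n k} → Vec (Fin n) n → Seg n k → Seg n k → Set
Similar Π A B = ∀ j j' → j Fin.< j' →
  ((lookup Π (pos A j) Fin.< lookup Π (pos A j')) ⇔ (lookup Π (pos B j) Fin.< lookup Π (pos B j')))

dec⇔ : ∀ {P Q : Set} → Dec P → Dec Q → Dec (P ⇔ Q)
dec⇔ p q = map′ (λ x → mk⇔ (proj₁ x) (proj₂ x)) (λ e → Equivalence.to e , Equivalence.from e) ((p →-dec q) ×-dec (q →-dec p))

similar? : ∀ {n k} (Π : Vec (Fin n) n) (A B : Seg n k) → Dec (Similar Π A B)
similar? Π A B = all? λ j → all? λ j' → (j <? j') →-dec
  dec⇔ (lookup Π (pos A _) <? lookup Π (pos A _)) (lookup Π (pos B _) <? lookup Π (pos B _))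

allVecs : ∀ {X : Set} → List X → (m : ℕ) → List (Vec X m)
allVecs xs zero    = [ [] ]
allVecs xs (suc m) = concatMap (λ x → map (x ∷_) (allVecs xs m)) xs

allSeqs : (n : ℕ) → List (Vec (Fin n) n)
allSeqs n = allVecs (allFin n) n

-- number of permutations Π of [n] satisfying a decidable event E;
-- P(E) for uniform Π equals  count E / count (λ _ → ⊤)
count : ∀ {n} {E : Vec (Fin n) n → Set} → (∀ Π → Dec (E Π)) → ℕ
count {n} E? = length (filter (λ Π → isPerm? Π ×-dec E? Π) (allSeqs n))

numPerms : ℕ → ℕ
numPerms n = length (filter isPerm? (allSeqs n))

-- Events, for families A B : Fin r → Seg n k (index i ↔ pair (A_{i+1}, B_{i+1}))
-- E_1 ∩ ... ∩ E_r
AllE : ∀ {n k r} → (Fin r → Seg n k) → (Fin r → Seg n k) → Vec (Fin n) n → Set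
AllE A B Π = ∀ i → Similar Π (A i) (B i)

FirstE : ∀ {n k r} → (Fin r → Seg n k) → (Fin r → Seg n k) → Vec (Fin n) n → Set
FirstE A B Π = ∀ i → toℕ i ≡ 0 → Similar Π (A i) (B i)

RestE : ∀ {n k r} → (Fin r → Seg n k) → (Fin r → Seg n k) → Vec (Fin n) n → Set
RestE A B Π = ∀ i → 1 ℕ.≤ toℕ i → Similar Π (A i) (B i)

allE? : ∀ {n k r} (A B : Fin r → Seg n k) Π → Dec (AllE A B Π)
allE? A B Π = all? λ i → similar? Π (A i) (B i)

firstE? : ∀ {n k r} (A B : Fin r → Seg n k) Π → Dec (FirstE A B Π)
firstE? A B Π = all? λ i → (toℕ i ℕ.≟ 0) →-dec similar? Π (A i) (B i)

restE? : ∀ {n k r} (A B : Fin r → Seg n k) Π → Dec (RestE A B Π)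
restE? A B Π = all? λ i → (1 ℕ.≤? toℕ i) →-dec similar? Π (A i) (B i)

module Submission where

-- Let A₀ = A 0, B₀ = B 0 (the first pair) and let R be any event
-- that depends only on the values of Π at positions outside A₀.  Rearranging
-- the entries of Π on A₀ does not affect R, nor the entries on B₀ (which is
-- disjoint from A₀), so every permutation Σ with R is obtained in exactly one
-- way from a pair (Π , v) where Π satisfies R and E₁ (its patterns on A₀ and
-- B₀ agree) and v is a permutation of [k] (the pattern of Σ on A₀).  Hence
--     #(R) = #(R ∩ E₁) · k!                                        (count-factor)
-- Applied to R = E₂ ∩ ⋯ ∩ Eᵣ (which avoids A₀ by hypothesis) and to R = ⊤:
--     #(E₂ ∩ ⋯ ∩ Eᵣ) = #(E₁ ∩ ⋯ ∩ Eᵣ) · k!   and   n! = #(E₁) · k!,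
-- and the theorem follows by multiplying out.

open import Defs
open import Data.Nat as ℕ using (ℕ; zero; suc; _+_; _*_; _≤_; z≤n; s≤s)
import Data.Nat.Properties as ℕP
open import Data.Fin as Fin using (Fin; zero; suc; toℕ; fromℕ<; punchOut)
import Data.Fin.Properties as FinP
open import Data.Vec using (Vec; []; _∷_; lookup; tabulate)
import Data.Vec.Properties as VecP
open import Data.List as List using (List; []; _∷_; map; concatMap; _++_; length; filter; allFin)
import Data.List.Properties as ListP
open import Data.List.Membership.Propositional using (_∈_)
open import Data.List.Membership.Propositional.Properties using (∈-allFin)
open import Data.List.Relation.Unary.Any using (here; there)
import Data.Product.Properties as ProdP
open import Data.Product using (_×_; _,_; proj₁; proj₂; ∃; ∃₂)
open import Data.Unit using (tt)
open import Data.Empty using (⊥-elim)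
open import Function using (_∘_; id; _⇔_; mk⇔; Equivalence; Injective)
import Function.Properties.Equivalence as ⇔
open import Relation.Nullary using (Dec; yes; no; ¬_)
open import Relation.Nullary.Decidable using (_×-dec_)
open import Relation.Unary using (Decidable)
open import Relation.Binary.Definitions using (DecidableEquality; tri<; tri≈; tri>)
open import Relation.Binary.PropositionalEquality
open import Algebra.Properties.CommutativeSemigroup ℕP.+-commutativeSemigroup using () renaming (interchange to +-interchange)
open import Algebra.Properties.CommutativeSemigroup ℕP.*-commutativeSemigroup using () renaming (x∙yz≈y∙xz to *-left-comm)

private
  variable
    A B C : Set

𝟙 : {P : Set} → Dec P → ℕ
𝟙 (yes _) = 1
𝟙 (no _)  = 0

𝟙-yes : {P : Set} (d : Dec P) → P → 𝟙 d ≡ 1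
𝟙-yes (yes _) _ = refl
𝟙-yes (no ¬p) p = ⊥-elim (¬p p)

𝟙-no : {P : Set} (d : Dec P) → ¬ P → 𝟙 d ≡ 0
𝟙-no (yes p) ¬p = ⊥-elim (¬p p)
𝟙-no (no _)  _  = refl

𝟙-cong : {P Q : Set} (d : Dec P) (e : Dec Q) → (P → Q) → (Q → P) → 𝟙 d ≡ 𝟙 e
𝟙-cong (yes _) (yes _) _ _ = refl
𝟙-cong (yes p) (no ¬q) f _ = ⊥-elim (¬q (f p))
𝟙-cong (no ¬p) (yes q) _ g = ⊥-elim (¬p (g q))
𝟙-cong (no _)  (no _)  _ _ = refl

𝟙-mono : {P Q : Set} (d : Dec P) (e : Dec Q) → (P → Q) → 𝟙 d ≤ 𝟙 e
𝟙-mono (yes _) (yes _) _ = ℕP.≤-refl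
𝟙-mono (yes p) (no ¬q) f = ⊥-elim (¬q (f p))
𝟙-mono (no _)  _       _ = z≤n

𝟙-× : {P Q : Set} (d : Dec P) (e : Dec Q) → 𝟙 (d ×-dec e) ≡ 𝟙 d * 𝟙 e
𝟙-× (yes _) (yes _) = refl
𝟙-× (yes _) (no _)  = refl
𝟙-× (no _)  (yes _) = refl
𝟙-× (no _)  (no _)  = refl

∑ : List A → (A → ℕ) → ℕ
∑ []       h = 0
∑ (x ∷ xs) h = h x + ∑ xs h

∑-cong : ∀ xs {h h' : A → ℕ} → (∀ x → h x ≡ h' x) → ∑ xs h ≡ ∑ xs h'
∑-cong []       _ = refl
∑-cong (x ∷ xs) e = cong₂ _+_ (e x) (∑-cong xs e)

∑-zero : ∀ xs {h : A → ℕ} → (∀ x → h x ≡ 0) → ∑ xs h ≡ 0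
∑-zero []       _ = refl
∑-zero (x ∷ xs) e = cong₂ _+_ (e x) (∑-zero xs e)

∑-mono : ∀ xs {h h' : A → ℕ} → (∀ x → h x ≤ h' x) → ∑ xs h ≤ ∑ xs h'
∑-mono []       _  = z≤n
∑-mono (x ∷ xs) le = ℕP.+-mono-≤ (le x) (∑-mono xs le)

∑-mono-< : ∀ {xs} {h h' : A → ℕ} {x} → x ∈ xs → (∀ y → h y ≤ h' y) → h x ℕ.< h' x → ∑ xs h ℕ.< ∑ xs h'
∑-mono-< {xs = _ ∷ xs} (here refl) le lt = ℕP.+-mono-<-≤ lt (∑-mono xs le)
∑-mono-< (there x∈xs)              le lt = ℕP.+-mono-≤-< (le _) (∑-mono-< x∈xs le lt)

∑-*ˡ : ∀ xs c (h : A → ℕ) → ∑ xs (λ x → c * h x) ≡ c * ∑ xs h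
∑-*ˡ []       c h = sym (ℕP.*-zeroʳ c)
∑-*ˡ (x ∷ xs) c h = trans (cong (c * h x +_) (∑-*ˡ xs c h)) (sym (ℕP.*-distribˡ-+ c (h x) (∑ xs h)))

∑-*ʳ : ∀ xs c (h : A → ℕ) → ∑ xs (λ x → h x * c) ≡ ∑ xs h * c
∑-*ʳ []       c h = refl
∑-*ʳ (x ∷ xs) c h = trans (cong (h x * c +_) (∑-*ʳ xs c h)) (sym (ℕP.*-distribʳ-+ c (h x) (∑ xs h)))

∑-+ : ∀ xs (h h' : A → ℕ) → ∑ xs (λ x → h x + h' x) ≡ ∑ xs h + ∑ xs h'
∑-+ []       h h' = refl
∑-+ (x ∷ xs) h h' = trans (cong (h x + h' x +_) (∑-+ xs h h')) (+-interchange (h x) (h' x) (∑ xs h) (∑ xs h'))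

∑-++ : ∀ xs ys (h : A → ℕ) → ∑ (xs ++ ys) h ≡ ∑ xs h + ∑ ys h
∑-++ []       ys h = refl
∑-++ (x ∷ xs) ys h = trans (cong (h x +_) (∑-++ xs ys h)) (sym (ℕP.+-assoc (h x) (∑ xs h) (∑ ys h)))

∑-map : ∀ (f : A → B) xs (h : B → ℕ) → ∑ (map f xs) h ≡ ∑ xs (h ∘ f)
∑-map f []       h = refl
∑-map f (x ∷ xs) h = cong (h (f x) +_) (∑-map f xs h)

∑-swap : ∀ (xs : List A) (ys : List B) (h : A → B → ℕ) →
  ∑ xs (λ x → ∑ ys (h x)) ≡ ∑ ys (λ y → ∑ xs (λ x → h x y))
∑-swap []       ys h = sym (∑-zero ys (λ _ → refl))
∑-swap (x ∷ xs) ys h = trans (cong (∑ ys (h x) +_) (∑-swap xs ys h)) (sym (∑-+ ys (h x) _))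

∑-product : ∀ (xs : List A) (ys : List B) (f : A → ℕ) (g : B → ℕ) →
  ∑ xs (λ x → ∑ ys (λ y → f x * g y)) ≡ ∑ xs f * ∑ ys g
∑-product xs ys f g = trans (∑-cong xs (λ x → ∑-*ˡ ys (f x) g)) (∑-*ʳ xs (∑ ys g) f)

∑-1≡length : (xs : List A) → ∑ xs (λ _ → 1) ≡ length xs
∑-1≡length []       = refl
∑-1≡length (x ∷ xs) = cong suc (∑-1≡length xs)

length-filter≡∑ : ∀ {P : A → Set} (P? : Decidable P) xs → length (filter P? xs) ≡ ∑ xs (λ x → 𝟙 (P? x))
length-filter≡∑ P? []       = refl
length-filter≡∑ P? (x ∷ xs) with P? x
... | yes _ = cong suc (length-filter≡∑ P? xs)
... | no _  = length-filter≡∑ P? xs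

grid : (A → B → C) → List A → List B → List C
grid f xs ys = concatMap (λ x → map (f x) ys) xs

∑-grid : ∀ (f : A → B → C) xs ys (h : C → ℕ) → ∑ (grid f xs ys) h ≡ ∑ xs (λ x → ∑ ys (λ y → h (f x y)))
∑-grid f []       ys h = refl
∑-grid f (x ∷ xs) ys h = begin
  ∑ (map (f x) ys ++ grid f xs ys) h         ≡⟨ ∑-++ (map (f x) ys) (grid f xs ys) h ⟩
  ∑ (map (f x) ys) h + ∑ (grid f xs ys) h    ≡⟨ cong₂ _+_ (∑-map (f x) ys h) (∑-grid f xs ys h) ⟩
  ∑ ys (h ∘ f x) + ∑ xs (λ x' → ∑ ys (λ y → h (f x' y))) ∎
  where open ≡-Reasoning

Enumerates : DecidableEquality A → List A → Set
Enumerates _≟_ xs = ∀ c → ∑ xs (λ x → 𝟙 (x ≟ c)) ≡ 1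

∑-allFin-suc : ∀ n (h : Fin (suc n) → ℕ) → ∑ (allFin (suc n)) h ≡ h zero + ∑ (allFin n) (h ∘ suc)
∑-allFin-suc n h = cong (h zero +_) (begin
  ∑ (List.tabulate suc) h          ≡⟨ cong (λ l → ∑ l h) (ListP.map-tabulate id suc) ⟨
  ∑ (map suc (allFin n)) h         ≡⟨ ∑-map suc (allFin n) h ⟩
  ∑ (allFin n) (h ∘ suc)           ∎)
  where open ≡-Reasoning

enumerates-allFin : ∀ n → Enumerates FinP._≟_ (allFin n)
enumerates-allFin (suc n) zero = trans (∑-allFin-suc n (λ x → 𝟙 (x FinP.≟ zero)))
  (cong suc (∑-zero (allFin n) (λ x → 𝟙-no (suc x FinP.≟ zero) (λ ()))))
enumerates-allFin (suc n) (suc c) = trans (∑-allFin-suc n (λ x → 𝟙 (x FinP.≟ suc c)))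
  (trans (∑-cong (allFin n) (λ x → 𝟙-cong (suc x FinP.≟ suc c) (x FinP.≟ c) FinP.suc-injective (cong suc)))
         (enumerates-allFin n c))

enumerates-grid : (_≟A_ : DecidableEquality A) (_≟B_ : DecidableEquality B) (_≟C_ : DecidableEquality C)
  (f : A → B → C) → (∀ {x x' y y'} → f x y ≡ f x' y' → x ≡ x' × y ≡ y') → (∀ c → ∃₂ λ a b → f a b ≡ c) →
  ∀ {xs ys} → Enumerates _≟A_ xs → Enumerates _≟B_ ys → Enumerates _≟C_ (grid f xs ys)
enumerates-grid _≟A_ _≟B_ _≟C_ f f-inj f-onto {xs} {ys} enum-xs enum-ys c with f-onto c
... | a , b , refl = begin
  ∑ (grid f xs ys) (λ z → 𝟙 (z ≟C f a b))                         ≡⟨ ∑-grid f xs ys _ ⟩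
  ∑ xs (λ x → ∑ ys (λ y → 𝟙 (f x y ≟C f a b)))                   ≡⟨ ∑-cong xs (λ x → ∑-cong ys (λ y → splits x y)) ⟩
  ∑ xs (λ x → ∑ ys (λ y → 𝟙 (x ≟A a) * 𝟙 (y ≟B b)))             ≡⟨ ∑-product xs ys _ _ ⟩
  ∑ xs (λ x → 𝟙 (x ≟A a)) * ∑ ys (λ y → 𝟙 (y ≟B b))             ≡⟨ cong₂ _*_ (enum-xs a) (enum-ys b) ⟩
  1 ∎
  where
  open ≡-Reasoning
  splits : ∀ x y → 𝟙 (f x y ≟C f a b) ≡ 𝟙 (x ≟A a) * 𝟙 (y ≟B b)
  splits x y = trans (𝟙-cong (f x y ≟C f a b) ((x ≟A a) ×-dec (y ≟B b)) f-inj (λ { (refl , refl) → refl }))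
                     (𝟙-× (x ≟A a) (y ≟B b))

enumerates-allVecs : (_≟_ : DecidableEquality A) → ∀ {xs} → Enumerates _≟_ xs →
  ∀ m → Enumerates (VecP.≡-dec _≟_) (allVecs xs m)
enumerates-allVecs _≟_ enum zero [] = refl
enumerates-allVecs _≟_ {xs} enum (suc m) =
  enumerates-grid _≟_ (VecP.≡-dec _≟_) (VecP.≡-dec _≟_) _∷_ VecP.∷-injective (λ { (a ∷ as) → a , as , refl })
    {xs} {allVecs xs m} enum (enumerates-allVecs _≟_ enum m)

record Correspondence (P : A → Set) (Q : B → Set) : Set where
  field
    to      : A → B
    from    : B → A
    to-Q    : ∀ {x} → P x → Q (to x)
    from-P  : ∀ {y} → Q y → P (from y)
    from∘to : ∀ {x} → P x → from (to x) ≡ x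
    to∘from : ∀ {y} → Q y → to (from y) ≡ y

-- Bijection principle: corresponding predicates are satisfied equally often
-- along enumerations.  Each x with P x is counted once, at y = to x.
∑-bijection : (_≟A_ : DecidableEquality A) (_≟B_ : DecidableEquality B) {xs : List A} {ys : List B} →
  Enumerates _≟A_ xs → Enumerates _≟B_ ys →
  {P : A → Set} {Q : B → Set} (P? : Decidable P) (Q? : Decidable Q) → Correspondence P Q →
  ∑ xs (λ x → 𝟙 (P? x)) ≡ ∑ ys (λ y → 𝟙 (Q? y))
∑-bijection _≟A_ _≟B_ {xs} {ys} enum-xs enum-ys P? Q? corr = begin
  ∑ xs (λ x → 𝟙 (P? x))                                     ≡⟨ ∑-cong xs (λ x → trans (cong (_* 𝟙 (P? x)) (enum-ys (to x))) (ℕP.*-identityˡ _)) ⟨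
  ∑ xs (λ x → ∑ ys (λ y → 𝟙 (y ≟B to x)) * 𝟙 (P? x))       ≡⟨ ∑-cong xs (λ x → ∑-*ʳ ys (𝟙 (P? x)) _) ⟨
  ∑ xs (λ x → ∑ ys (λ y → 𝟙 (y ≟B to x) * 𝟙 (P? x)))       ≡⟨ ∑-swap xs ys _ ⟩
  ∑ ys (λ y → ∑ xs (λ x → 𝟙 (y ≟B to x) * 𝟙 (P? x)))       ≡⟨ ∑-cong ys fibre ⟩
  ∑ ys (λ y → 𝟙 (Q? y))                                     ∎
  where
  open ≡-Reasoning
  open Correspondence corr
  fibre : ∀ y → ∑ xs (λ x → 𝟙 (y ≟B to x) * 𝟙 (P? x)) ≡ 𝟙 (Q? y)
  fibre y with Q? y
  ... | yes qy = trans (∑-cong xs (λ x → trans (sym (𝟙-× (y ≟B to x) (P? x)))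
                  (𝟙-cong ((y ≟B to x) ×-dec P? x) (x ≟A from y)
                     (λ { (refl , px) → sym (from∘to px) }) (λ { refl → sym (to∘from qy) , from-P qy }))))
                 (enum-xs (from y))
  ... | no ¬qy = ∑-zero xs (λ x → trans (sym (𝟙-× (y ≟B to x) (P? x)))
                  (𝟙-no ((y ≟B to x) ×-dec P? x) (λ { (refl , px) → ¬qy (to-Q px) })))

injective⇒surjective : ∀ {k} (f : Fin k → Fin k) → Injective _≡_ _≡_ f → ∀ y → ∃ λ j → f j ≡ y
injective⇒surjective {suc k} f f-inj y with FinP.any? (λ j → f j FinP.≟ y)
... | yes hit = hit
... | no miss = ⊥-elim (ℕP.1+n≰n (FinP.injective⇒≤ {f = squeeze} squeeze-injective))
  where
  -- f with the value y (never attained) removed from its codomain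
  squeeze : Fin (suc k) → Fin k
  squeeze j = punchOut (λ e → miss (j , sym e))
  squeeze-injective : Injective _≡_ _≡_ squeeze
  squeeze-injective {x} {z} e =
    f-inj (FinP.punchOut-injective (λ e′ → miss (x , sym e′)) (λ e′ → miss (z , sym e′)) e)

-- A preimage of y under f, chosen by search (y itself if there is none).
-- Total, so that it can be used to define maps on arbitrary sequences.
inv : ∀ {k} → (Fin k → Fin k) → Fin k → Fin k
inv f y with FinP.any? (λ j → f j FinP.≟ y)
... | yes (j , _) = j
... | no _        = y

module _ {k : ℕ} (f : Fin k → Fin k) (f-inj : Injective _≡_ _≡_ f) where

  inv-r : ∀ y → f (inv f y) ≡ y
  inv-r y with FinP.any? (λ j → f j FinP.≟ y)
  ... | yes (_ , e) = e
  ... | no miss     = ⊥-elim (miss (injective⇒surjective f f-inj y))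

  inv-l : ∀ x → inv f (f x) ≡ x
  inv-l x = f-inj (inv-r (f x))

  inv-injective : Injective _≡_ _≡_ (inv f)
  inv-injective {x} {y} e = trans (sym (inv-r x)) (trans (cong f e) (inv-r y))

inv-cong : ∀ {k} {f f' : Fin k → Fin k} → Injective _≡_ _≡_ f → Injective _≡_ _≡_ f' →
  (∀ x → f x ≡ f' x) → ∀ y → inv f y ≡ inv f' y
inv-cong {f = f} {f'} f-inj f'-inj e y =
  f'-inj (trans (sym (e (inv f y))) (trans (inv-r f f-inj y) (sym (inv-r f' f'-inj y))))

∘-injective : {f : B → C} {g : A → B} → Injective _≡_ _≡_ f → Injective _≡_ _≡_ g → Injective _≡_ _≡_ (f ∘ g)
∘-injective f-inj g-inj = g-inj ∘ f-inj

pos-injective : ∀ {n k} (S : Seg n k) → Injective _≡_ _≡_ (pos S)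
pos-injective S {j} {j'} e = FinP.toℕ-injective (ℕP.+-cancelˡ-≡ (Seg.start S) _ _
  (trans (sym (FinP.toℕ-fromℕ< _)) (trans (cong toℕ e) (FinP.toℕ-fromℕ< _))))

valuesOn : ∀ {n k} → Seg n k → Vec (Fin n) n → Fin k → Fin n
valuesOn S Π j = lookup Π (pos S j)

valuesOn-injective : ∀ {n k} (S : Seg n k) (Π : Vec (Fin n) n) → IsPerm Π → Injective _≡_ _≡_ (valuesOn S Π)
valuesOn-injective S Π Π-perm e = pos-injective S (Π-perm _ _ e)

SameOrder : ∀ {k n m} → (Fin k → Fin n) → (Fin k → Fin m) → Set
SameOrder u w = ∀ x y → (u x Fin.< u y) ⇔ (w x Fin.< w y)

module _ {k n m : ℕ} {u : Fin k → Fin n} {w : Fin k → Fin m} where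

  sameOrder-sym : SameOrder u w → SameOrder w u
  sameOrder-sym s x y = ⇔.sym (s x y)

  sameOrder-injective : SameOrder u w → Injective _≡_ _≡_ u → Injective _≡_ _≡_ w
  sameOrder-injective s u-inj {x} {y} e with FinP.<-cmp (u x) (u y)
  ... | tri< ux<uy _ _ = ⊥-elim (FinP.<-irrefl e (Equivalence.to (s x y) ux<uy))
  ... | tri≈ _ ux≡uy _ = u-inj ux≡uy
  ... | tri> _ _ uy<ux = ⊥-elim (FinP.<-irrefl (sym e) (Equivalence.to (s y x) uy<ux))

  ordered⇒sameOrder : Injective _≡_ _≡_ u → Injective _≡_ _≡_ w →
    (∀ x y → x Fin.< y → (u x Fin.< u y) ⇔ (w x Fin.< w y)) → SameOrder u w
  ordered⇒sameOrder u-inj w-inj s x y with FinP.<-cmp x y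
  ... | tri< x<y _ _ = s x y x<y
  ... | tri≈ _ refl _ = mk⇔ (λ l → ⊥-elim (FinP.<-irrefl refl l)) (λ l → ⊥-elim (FinP.<-irrefl refl l))
  ... | tri> _ x≢y y<x = mk⇔ (reverse u w w-inj (s y x y<x)) (reverse w u u-inj (⇔.sym (s y x y<x)))
    where
    reverse : ∀ {a b} (f : Fin k → Fin a) (g : Fin k → Fin b) → Injective _≡_ _≡_ g →
      (f y Fin.< f x) ⇔ (g y Fin.< g x) → f x Fin.< f y → g x Fin.< g y
    reverse f g g-inj fy<fx⇔gy<gx fx<fy = FinP.≤∧≢⇒<
      (ℕP.≮⇒≥ (λ gy<gx → FinP.<-asym fx<fy (Equivalence.from fy<fx⇔gy<gx gy<gx)))
      (λ e → x≢y (g-inj e))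

sameOrder-trans : ∀ {k a b c} {u : Fin k → Fin a} {v : Fin k → Fin b} {w : Fin k → Fin c} →
  SameOrder u v → SameOrder v w → SameOrder u w
sameOrder-trans s t x y = ⇔.trans (s x y) (t x y)

≗⇒sameOrder : ∀ {k n} {u w : Fin k → Fin n} → (∀ x → u x ≡ w x) → SameOrder u w
≗⇒sameOrder e x y = mk⇔ (subst₂ Fin._<_ (e x) (e y)) (subst₂ Fin._<_ (sym (e x)) (sym (e y)))

module _ {k n : ℕ} (u : Fin k → Fin n) where

  #below : Fin k → ℕ
  #below j = ∑ (allFin k) (λ x → 𝟙 (u x FinP.<? u j))

  #below<k : ∀ j → #below j ℕ.< k
  #below<k j = subst (#below j ℕ.<_) (trans (∑-1≡length (allFin k)) (ListP.length-tabulate id))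
    (∑-mono-< (∈-allFin j) (λ x → 𝟙-mono (u x FinP.<? u j) (yes tt) _)
      (subst (ℕ._< 1) (sym (𝟙-no (u j FinP.<? u j) (FinP.<-irrefl refl))) (s≤s z≤n)))

  rank : Fin k → Fin k
  rank j = fromℕ< (#below<k j)

  toℕ-rank : ∀ j → toℕ (rank j) ≡ #below j
  toℕ-rank j = FinP.toℕ-fromℕ< (#below<k j)

  rank-< : ∀ {i j} → u i Fin.< u j → rank i Fin.< rank j
  rank-< {i} {j} ui<uj = subst₂ ℕ._<_ (sym (toℕ-rank i)) (sym (toℕ-rank j))
    (∑-mono-< (∈-allFin i) (λ x → 𝟙-mono (u x FinP.<? u i) (u x FinP.<? u j) (λ l → FinP.<-trans l ui<uj))
      (subst₂ ℕ._<_ (sym (𝟙-no (u i FinP.<? u i) (FinP.<-irrefl refl))) (sym (𝟙-yes (u i FinP.<? u j) ui<uj))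
        (s≤s z≤n)))

  rank-<⁻ : ∀ {i j} → rank i Fin.< rank j → u i Fin.< u j
  rank-<⁻ {i} {j} ri<rj with u i FinP.<? u j
  ... | yes ui<uj = ui<uj
  ... | no ui≮uj = ⊥-elim (ℕP.<⇒≱ ri<rj (subst₂ _≤_ (sym (toℕ-rank j)) (sym (toℕ-rank i))
          (∑-mono (allFin k) (λ x → 𝟙-mono (u x FinP.<? u j) (u x FinP.<? u i)
             (λ ux<uj → ℕP.<-≤-trans ux<uj (ℕP.≮⇒≥ ui≮uj))))))

  sameOrder-rank : SameOrder u rank
  sameOrder-rank x y = mk⇔ rank-< rank-<⁻

sameOrder⇒rank≗ : ∀ {k n m} {u : Fin k → Fin n} {w : Fin k → Fin m} → SameOrder u w → ∀ j → rank u j ≡ rank w j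
sameOrder⇒rank≗ {k} {u = u} {w} s j = FinP.toℕ-injective (begin
  toℕ (rank u j)                                 ≡⟨ toℕ-rank u j ⟩
  ∑ (allFin k) (λ x → 𝟙 (u x FinP.<? u j))       ≡⟨ ∑-cong (allFin k) (λ x → 𝟙-cong (u x FinP.<? u j) (w x FinP.<? w j)
                                                      (Equivalence.to (s x j)) (Equivalence.from (s x j))) ⟩
  ∑ (allFin k) (λ x → 𝟙 (w x FinP.<? w j))       ≡⟨ toℕ-rank w j ⟨
  toℕ (rank w j)                                 ∎)
  where open ≡-Reasoning

rank≗⇒sameOrder : ∀ {k n m} {u : Fin k → Fin n} {w : Fin k → Fin m} → (∀ j → rank u j ≡ rank w j) → SameOrder u w
rank≗⇒sameOrder {u = u} {w} e =
  sameOrder-trans (sameOrder-rank u) (sameOrder-trans (≗⇒sameOrder e) (sameOrder-sym (sameOrder-rank w)))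

rank-injective : ∀ {k n} (u : Fin k → Fin n) → Injective _≡_ _≡_ u → Injective _≡_ _≡_ (rank u)
rank-injective u = sameOrder-injective (sameOrder-rank u)

rank-∘ : ∀ {k n} (u : Fin k → Fin n) (τ : Fin k → Fin k) → Injective _≡_ _≡_ τ → ∀ j → rank (u ∘ τ) j ≡ rank u (τ j)
rank-∘ {k} u τ τ-inj j = FinP.toℕ-injective (begin
  toℕ (rank (u ∘ τ) j)                                ≡⟨ toℕ-rank (u ∘ τ) j ⟩
  ∑ (allFin k) (λ x → 𝟙 (u (τ x) FinP.<? u (τ j)))    ≡⟨ ∑-bijection FinP._≟_ FinP._≟_ {allFin k} {allFin k} (enumerates-allFin k) (enumerates-allFin k)
                                                           (λ x → u (τ x) FinP.<? u (τ j)) (λ y → u y FinP.<? u (τ j)) reindex ⟩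
  ∑ (allFin k) (λ y → 𝟙 (u y FinP.<? u (τ j)))        ≡⟨ toℕ-rank u (τ j) ⟨
  toℕ (rank u (τ j))                                  ∎)
  where
  open ≡-Reasoning
  reindex : Correspondence (λ x → u (τ x) Fin.< u (τ j)) (λ y → u y Fin.< u (τ j))
  reindex = record
    { to = τ ; from = inv τ
    ; to-Q = id
    ; from-P = λ {y} l → subst (λ z → u z Fin.< u (τ j)) (sym (inv-r τ τ-inj y)) l
    ; from∘to = λ {x} _ → inv-l τ τ-inj x
    ; to∘from = λ {y} _ → inv-r τ τ-inj y
    }

ranksOn : ∀ {n k} → Seg n k → Vec (Fin n) n → Fin k → Fin k
ranksOn S Π = rank (valuesOn S Π)

similar⇒ranks≗ : ∀ {n k} (S T : Seg n k) (Π : Vec (Fin n) n) → IsPerm Π → Similar Π S T → ∀ j → ranksOn S Π j ≡ ranksOn T Π j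
similar⇒ranks≗ S T Π Π-perm sim =
  sameOrder⇒rank≗ (ordered⇒sameOrder (valuesOn-injective S Π Π-perm) (valuesOn-injective T Π Π-perm) sim)

ranks≗⇒similar : ∀ {n k} (S T : Seg n k) (Π : Vec (Fin n) n) → (∀ j → ranksOn S Π j ≡ ranksOn T Π j) → Similar Π S T
ranks≗⇒similar S T Π e j j' _ = rank≗⇒sameOrder e j j'

similar-transfer : ∀ {n k} (S T : Seg n k) (Π Π' : Vec (Fin n) n) →
  (∀ j → valuesOn S Π j ≡ valuesOn S Π' j) → (∀ j → valuesOn T Π j ≡ valuesOn T Π' j) →
  Similar Π S T → Similar Π' S T
similar-transfer S T Π Π' eS eT sim j j' j<j' =
  ⇔.trans (⇔.sym (≗⇒sameOrder eS j j')) (⇔.trans (sim j j' j<j') (≗⇒sameOrder eT j j'))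

ranksOn-injective : ∀ {n k} (S : Seg n k) (Π : Vec (Fin n) n) → IsPerm Π → Injective _≡_ _≡_ (ranksOn S Π)
ranksOn-injective S Π Π-perm = rank-injective (valuesOn S Π) (valuesOn-injective S Π Π-perm)

Outside : ∀ {n k} → Seg n k → Fin n → Set
Outside S p = ∀ j → pos S j ≢ p

DependsOnlyOutside : ∀ {n k} → Seg n k → (Vec (Fin n) n → Set) → Set
DependsOnlyOutside {n} S R =
  ∀ (Π Π' : Vec (Fin n) n) → (∀ p → Outside S p → lookup Π p ≡ lookup Π' p) → R Π → R Π'

module Rearrangement {n k : ℕ} (A₀ : Seg n k) where

  move : (Fin k → Fin k) → Fin n → Fin n
  move τ p with FinP.any? (λ j → pos A₀ j FinP.≟ p)
  ... | yes (j , _) = pos A₀ (τ j)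
  ... | no _        = p

  move-inside : ∀ τ j → move τ (pos A₀ j) ≡ pos A₀ (τ j)
  move-inside τ j with FinP.any? (λ j' → pos A₀ j' FinP.≟ pos A₀ j)
  ... | yes (j' , e) = cong (pos A₀ ∘ τ) (pos-injective A₀ e)
  ... | no miss      = ⊥-elim (miss (j , refl))

  move-outside : ∀ τ {p} → Outside A₀ p → move τ p ≡ p
  move-outside τ {p} out with FinP.any? (λ j → pos A₀ j FinP.≟ p)
  ... | yes (j , e) = ⊥-elim (out j e)
  ... | no _        = refl

  move-∘ : ∀ τ σ → (∀ j → σ (τ j) ≡ j) → ∀ p → move σ (move τ p) ≡ p
  move-∘ τ σ στ p with FinP.any? (λ j → pos A₀ j FinP.≟ p)
  ... | yes (j , refl) = trans (move-inside σ (τ j)) (cong (pos A₀) (στ j))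
  ... | no miss        = move-outside σ (λ j e → miss (j , e))

  rearrange : (Fin k → Fin k) → Vec (Fin n) n → Vec (Fin n) n
  rearrange τ Π = tabulate (lookup Π ∘ move τ)

  rearrange-inside : ∀ τ Π j → valuesOn A₀ (rearrange τ Π) j ≡ valuesOn A₀ Π (τ j)
  rearrange-inside τ Π j = trans (VecP.lookup∘tabulate _ (pos A₀ j)) (cong (lookup Π) (move-inside τ j))

  rearrange-outside : ∀ τ Π {p} → Outside A₀ p → lookup (rearrange τ Π) p ≡ lookup Π p
  rearrange-outside τ Π {p} out = trans (VecP.lookup∘tabulate _ p) (cong (lookup Π) (move-outside τ out))

  rearrange-∘ : ∀ τ σ → (∀ j → σ (τ j) ≡ j) → ∀ Π → rearrange τ (rearrange σ Π) ≡ Π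
  rearrange-∘ τ σ στ Π = trans (VecP.tabulate-cong (λ p → begin
    lookup (rearrange σ Π) (move τ p)  ≡⟨ VecP.lookup∘tabulate _ (move τ p) ⟩
    lookup Π (move σ (move τ p))       ≡⟨ cong (lookup Π) (move-∘ τ σ στ p) ⟩
    lookup Π p                         ∎)) (VecP.tabulate∘lookup Π)
    where open ≡-Reasoning

  rearrange-perm : ∀ τ → Injective _≡_ _≡_ τ → ∀ Π → IsPerm Π → IsPerm (rearrange τ Π)
  rearrange-perm τ τ-inj Π Π-perm p q e = begin
    p                           ≡⟨ move-∘ τ (inv τ) (inv-l τ τ-inj) p ⟨
    move (inv τ) (move τ p)     ≡⟨ cong (move (inv τ)) (Π-perm _ _ (begin
      lookup Π (move τ p)          ≡⟨ VecP.lookup∘tabulate _ p ⟨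
      lookup (rearrange τ Π) p     ≡⟨ e ⟩
      lookup (rearrange τ Π) q     ≡⟨ VecP.lookup∘tabulate _ q ⟩
      lookup Π (move τ q)          ∎)) ⟩
    move (inv τ) (move τ q)     ≡⟨ move-∘ τ (inv τ) (inv-l τ τ-inj) q ⟩
    q                           ∎
    where open ≡-Reasoning

  ranksOn-inside : ∀ τ → Injective _≡_ _≡_ τ → ∀ Π j → ranksOn A₀ (rearrange τ Π) j ≡ ranksOn A₀ Π (τ j)
  ranksOn-inside τ τ-inj Π j =
    trans (sameOrder⇒rank≗ (≗⇒sameOrder (rearrange-inside τ Π)) j) (rank-∘ (valuesOn A₀ Π) τ τ-inj j)

  rearrange-preserves : ∀ {R} → DependsOnlyOutside A₀ R → ∀ τ Π → R Π → R (rearrange τ Π)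
  rearrange-preserves R-outside τ Π = R-outside Π (rearrange τ Π) (λ p out → sym (rearrange-outside τ Π out))

count≡∑ : ∀ {n} {E : Vec (Fin n) n → Set} (E? : ∀ Π → Dec (E Π)) →
  count E? ≡ ∑ (allSeqs n) (λ Π → 𝟙 (isPerm? Π ×-dec E? Π))
count≡∑ {n} E? = length-filter≡∑ (λ Π → isPerm? Π ×-dec E? Π) (allSeqs n)

count-cong : ∀ {n} {E E' : Vec (Fin n) n → Set} (E? : ∀ Π → Dec (E Π)) (E'? : ∀ Π → Dec (E' Π)) →
  (∀ {Π} → E Π → E' Π) → (∀ {Π} → E' Π → E Π) → count E? ≡ count E'?
count-cong {n} E? E'? to from = trans (count≡∑ E?) (trans (∑-cong (allSeqs n) (λ Π →
  𝟙-cong (isPerm? Π ×-dec E? Π) (isPerm? Π ×-dec E'? Π) (λ (p , e) → p , to e) (λ (p , e) → p , from e)))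
  (sym (count≡∑ E'?)))

numPerms≡count-⊤ : ∀ n → numPerms n ≡ count {n} (λ _ → yes tt)
numPerms≡count-⊤ n = trans (length-filter≡∑ isPerm? (allSeqs n)) (trans (∑-cong (allSeqs n) (λ Π →
  𝟙-cong (isPerm? Π) (isPerm? Π ×-dec yes tt) (_, tt) proj₁)) (sym (count≡∑ {n} (λ _ → yes tt))))

module Factorisation {n k : ℕ} (A₀ B₀ : Seg n k) (A₀∩B₀=∅ : Disjoint A₀ B₀) where

  open Rearrangement A₀

  -- B₀ lies outside A₀, so rearranging on A₀ does not change the pattern on B₀
  ranksOn-B₀ : ∀ τ Π j → ranksOn B₀ (rearrange τ Π) j ≡ ranksOn B₀ Π j
  ranksOn-B₀ τ Π = sameOrder⇒rank≗ (≗⇒sameOrder (λ j → rearrange-outside τ Π (λ j' → A₀∩B₀=∅ j' j)))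

  -- the rearrangement of A₀ after which the pattern on A₀ equals the pattern on B₀
  align : Vec (Fin n) n → Fin k → Fin k
  align Σ = inv (ranksOn A₀ Σ) ∘ ranksOn B₀ Σ

  -- the rearrangement of A₀ after which the pattern on A₀ becomes v (if it equalled that on B₀)
  unalign : Vec (Fin n) n → Vec (Fin k) k → Fin k → Fin k
  unalign Π v = inv (ranksOn B₀ Π) ∘ lookup v

  module _ (Σ : Vec (Fin n) n) (Σ-perm : IsPerm Σ) where

    align-injective : Injective _≡_ _≡_ (align Σ)
    align-injective = ∘-injective (inv-injective (ranksOn A₀ Σ) (ranksOn-injective A₀ Σ Σ-perm))
                                  (ranksOn-injective B₀ Σ Σ-perm)

    aligned-similar : Similar (rearrange (align Σ) Σ) A₀ B₀
    aligned-similar = ranks≗⇒similar A₀ B₀ (rearrange (align Σ) Σ) λ j → begin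
      ranksOn A₀ (rearrange (align Σ) Σ) j   ≡⟨ ranksOn-inside (align Σ) align-injective Σ j ⟩
      ranksOn A₀ Σ (align Σ j)               ≡⟨ inv-r (ranksOn A₀ Σ) (ranksOn-injective A₀ Σ Σ-perm) _ ⟩
      ranksOn B₀ Σ j                         ≡⟨ ranksOn-B₀ (align Σ) Σ j ⟨
      ranksOn B₀ (rearrange (align Σ) Σ) j   ∎
      where open ≡-Reasoning

  module _ (Π : Vec (Fin n) n) (v : Vec (Fin k) k) (Π-perm : IsPerm Π) (v-perm : IsPerm v) where

    unalign-injective : Injective _≡_ _≡_ (unalign Π v)
    unalign-injective = ∘-injective (inv-injective (ranksOn B₀ Π) (ranksOn-injective B₀ Π Π-perm)) (v-perm _ _)

    unaligned-pattern : Similar Π A₀ B₀ → ∀ j → ranksOn A₀ (rearrange (unalign Π v) Π) j ≡ lookup v j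
    unaligned-pattern sim j = begin
      ranksOn A₀ (rearrange (unalign Π v) Π) j   ≡⟨ ranksOn-inside (unalign Π v) unalign-injective Π j ⟩
      ranksOn A₀ Π (unalign Π v j)               ≡⟨ similar⇒ranks≗ A₀ B₀ Π Π-perm sim _ ⟩
      ranksOn B₀ Π (unalign Π v j)               ≡⟨ inv-r (ranksOn B₀ Π) (ranksOn-injective B₀ Π Π-perm) _ ⟩
      lookup v j                                 ∎
      where open ≡-Reasoning

  unalign∘align : ∀ Σ → IsPerm Σ →
    let Π = rearrange (align Σ) Σ in rearrange (unalign Π (tabulate (ranksOn A₀ Σ))) Π ≡ Σ
  unalign∘align Σ Σ-perm = rearrange-∘ (unalign Π (tabulate a)) (align Σ) (λ j → begin
    align Σ (inv bΠ (lookup (tabulate a) j))  ≡⟨ cong (align Σ) (inv-cong bΠ-inj b-inj (ranksOn-B₀ (align Σ) Σ) _) ⟩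
    align Σ (inv b (lookup (tabulate a) j))   ≡⟨ cong (align Σ ∘ inv b) (VecP.lookup∘tabulate a j) ⟩
    inv a (b (inv b (a j)))                   ≡⟨ cong (inv a) (inv-r b b-inj (a j)) ⟩
    inv a (a j)                               ≡⟨ inv-l a a-inj j ⟩
    j                                         ∎) Σ
    where
    open ≡-Reasoning
    Π : Vec (Fin n) n
    Π = rearrange (align Σ) Σ
    a b bΠ : Fin k → Fin k
    a = ranksOn A₀ Σ
    b = ranksOn B₀ Σ
    bΠ = ranksOn B₀ Π
    a-inj : Injective _≡_ _≡_ a
    a-inj = ranksOn-injective A₀ Σ Σ-perm
    b-inj : Injective _≡_ _≡_ b
    b-inj = ranksOn-injective B₀ Σ Σ-perm
    bΠ-inj : Injective _≡_ _≡_ bΠ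
    bΠ-inj = ranksOn-injective B₀ Π (rearrange-perm (align Σ) (align-injective Σ Σ-perm) Σ Σ-perm)

  align∘unalign : ∀ Π v → IsPerm Π → IsPerm v → Similar Π A₀ B₀ →
    let Σ = rearrange (unalign Π v) Π in (rearrange (align Σ) Σ , tabulate (ranksOn A₀ Σ)) ≡ (Π , v)
  align∘unalign Π v Π-perm v-perm sim = cong₂ _,_
    (rearrange-∘ (align Σ) (unalign Π v) (λ j → begin
      unalign Π v (inv aΣ (bΣ j))              ≡⟨ cong (unalign Π v) (inv-cong aΣ-inj (v-perm _ _) pattern-v _) ⟩
      unalign Π v (inv (lookup v) (bΣ j))      ≡⟨ cong (unalign Π v ∘ inv (lookup v)) (ranksOn-B₀ (unalign Π v) Π j) ⟩
      inv b (lookup v (inv (lookup v) (b j)))  ≡⟨ cong (inv b) (inv-r (lookup v) (v-perm _ _) (b j)) ⟩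
      inv b (b j)                              ≡⟨ inv-l b (ranksOn-injective B₀ Π Π-perm) j ⟩
      j                                        ∎) Π)
    (trans (VecP.tabulate-cong pattern-v) (VecP.tabulate∘lookup v))
    where
    open ≡-Reasoning
    Σ : Vec (Fin n) n
    Σ = rearrange (unalign Π v) Π
    aΣ bΣ b : Fin k → Fin k
    aΣ = ranksOn A₀ Σ
    bΣ = ranksOn B₀ Σ
    b = ranksOn B₀ Π
    pattern-v : ∀ j → aΣ j ≡ lookup v j
    pattern-v = unaligned-pattern Π v Π-perm v-perm sim
    aΣ-inj : Injective _≡_ _≡_ aΣ
    aΣ-inj = ranksOn-injective A₀ Σ (rearrange-perm (unalign Π v) (unalign-injective Π v Π-perm v-perm) Π Π-perm)

  module _ {R : Vec (Fin n) n → Set} (R? : ∀ Π → Dec (R Π)) (R-outside : DependsOnlyOutside A₀ R) where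

    Before : Vec (Fin n) n → Set
    Before Σ = IsPerm Σ × R Σ

    After : Vec (Fin n) n × Vec (Fin k) k → Set
    After (Π , v) = (IsPerm Π × (R Π × Similar Π A₀ B₀)) × IsPerm v

    -- Σ ↦ (Σ aligned on A₀ , pattern of Σ on A₀), with inverse (Π , v) ↦ Π unaligned by v
    correspondence : Correspondence Before After
    correspondence = record
      { to      = λ Σ → rearrange (align Σ) Σ , tabulate (ranksOn A₀ Σ)
      ; from    = λ (Π , v) → rearrange (unalign Π v) Π
      ; to-Q    = λ {Σ} (Σ-perm , r) →
          ( rearrange-perm (align Σ) (align-injective Σ Σ-perm) Σ Σ-perm
          , rearrange-preserves R-outside (align Σ) Σ r
          , aligned-similar Σ Σ-perm )
          , pattern-perm Σ Σ-perm
      ; from-P  = λ {(Π , v)} ((Π-perm , r , _) , v-perm) →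
          rearrange-perm (unalign Π v) (unalign-injective Π v Π-perm v-perm) Π Π-perm
          , rearrange-preserves R-outside (unalign Π v) Π r
      ; from∘to = λ {Σ} (Σ-perm , _) → unalign∘align Σ Σ-perm
      ; to∘from = λ {(Π , v)} ((Π-perm , _ , sim) , v-perm) → align∘unalign Π v Π-perm v-perm sim
      }
      where
      pattern-perm : ∀ Σ → IsPerm Σ → IsPerm (tabulate (ranksOn A₀ Σ))
      pattern-perm Σ Σ-perm i j e = ranksOn-injective A₀ Σ Σ-perm
        (trans (sym (VecP.lookup∘tabulate _ i)) (trans e (VecP.lookup∘tabulate _ j)))

    count-factor : count R? ≡ count (λ Π → R? Π ×-dec similar? Π A₀ B₀) * numPerms k
    count-factor = begin
      count R?
        ≡⟨ count≡∑ R? ⟩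
      ∑ Us (λ Σ → 𝟙 (isPerm? Σ ×-dec R? Σ))
        ≡⟨ ∑-bijection _≟ₙ_ _≟ₚ_ {Us} {grid _,_ Us Vs} enum-Us enum-pairs
             (λ Σ → isPerm? Σ ×-dec R? Σ) (λ (Π , v) → After₁? Π ×-dec isPerm? v) correspondence ⟩
      ∑ (grid _,_ Us Vs) (λ (Π , v) → 𝟙 (After₁? Π ×-dec isPerm? v))
        ≡⟨ ∑-grid _,_ Us Vs (λ (Π , v) → 𝟙 (After₁? Π ×-dec isPerm? v)) ⟩
      ∑ Us (λ Π → ∑ Vs (λ v → 𝟙 (After₁? Π ×-dec isPerm? v)))
        ≡⟨ ∑-cong Us (λ Π → ∑-cong Vs (λ v → 𝟙-× (After₁? Π) (isPerm? v))) ⟩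
      ∑ Us (λ Π → ∑ Vs (λ v → 𝟙 (After₁? Π) * 𝟙 (isPerm? v)))
        ≡⟨ ∑-product Us Vs (λ Π → 𝟙 (After₁? Π)) (λ v → 𝟙 (isPerm? v)) ⟩
      ∑ Us (λ Π → 𝟙 (After₁? Π)) * ∑ Vs (λ v → 𝟙 (isPerm? v))
        ≡⟨ cong₂ _*_ (count≡∑ (λ Π → R? Π ×-dec similar? Π A₀ B₀)) (length-filter≡∑ isPerm? Vs) ⟨
      count (λ Π → R? Π ×-dec similar? Π A₀ B₀) * numPerms k
        ∎
      where
      open ≡-Reasoning
      Us : List (Vec (Fin n) n)
      Us = allSeqs n
      Vs : List (Vec (Fin k) k)
      Vs = allSeqs k
      _≟ₙ_ : DecidableEquality (Vec (Fin n) n)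
      _≟ₙ_ = VecP.≡-dec FinP._≟_
      _≟ₖ_ : DecidableEquality (Vec (Fin k) k)
      _≟ₖ_ = VecP.≡-dec FinP._≟_
      _≟ₚ_ : DecidableEquality (Vec (Fin n) n × Vec (Fin k) k)
      _≟ₚ_ = ProdP.≡-dec _≟ₙ_ _≟ₖ_
      enum-Us : Enumerates _≟ₙ_ Us
      enum-Us = enumerates-allVecs FinP._≟_ {allFin n} (enumerates-allFin n) n
      enum-pairs : Enumerates _≟ₚ_ (grid _,_ Us Vs)
      enum-pairs = enumerates-grid _≟ₙ_ _≟ₖ_ _≟ₚ_ _,_ ProdP.,-injective (λ (Π , v) → Π , v , refl) {Us} {Vs}
        enum-Us (enumerates-allVecs FinP._≟_ {allFin k} (enumerates-allFin k) k)
      After₁? : ∀ Π → Dec (IsPerm Π × (R Π × Similar Π A₀ B₀))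
      After₁? Π = isPerm? Π ×-dec (R? Π ×-dec similar? Π A₀ B₀)

restE-outside : ∀ {n k r} (A B : Fin (suc r) → Seg n k) →
  (∀ i j → toℕ i ≡ 0 → 1 ≤ toℕ j → Disjoint (A i) (A j) × Disjoint (A i) (B j)) →
  DependsOnlyOutside (A zero) (RestE A B)
restE-outside A B apart Π Π' agree rest i 1≤i = similar-transfer (A i) (B i) Π Π'
  (λ j → agree _ (λ j' → proj₁ (apart zero i refl 1≤i) j' j))
  (λ j → agree _ (λ j' → proj₂ (apart zero i refl 1≤i) j' j))
  (rest i 1≤i)

-- P(E₁ ∩ ⋯ ∩ Eᵣ) = P(E₁) P(E₂ ∩ ⋯ ∩ Eᵣ), cleared of the denominators n!.
fact3p3 : (n k r : ℕ) → 1 ≤ n → 1 ≤ k → 2 ≤ r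
    → (A B : Fin r → Seg n k)
    → (∀ i → Disjoint (A i) (B i))
    → (∀ i j → toℕ i ≡ 0 → 1 ≤ toℕ j → Disjoint (A i) (A j) × Disjoint (A i) (B j))
    → count (allE? A B) * numPerms n ≡ count (firstE? A B) * count (restE? A B)
fact3p3 n k (suc r) _ _ _ A B A∩B=∅ A₁-apart = begin
  count (allE? A B) * numPerms n   ≡⟨ cong₂ _*_ all≡rest∩E₁ n!≡E₁·k! ⟩
  #rest∩E₁ * (#E₁ * numPerms k)    ≡⟨ *-left-comm #rest∩E₁ #E₁ (numPerms k) ⟩
  #E₁ * (#rest∩E₁ * numPerms k)    ≡⟨ cong₂ _*_ first≡E₁ (count-factor (restE? A B) (restE-outside A B A₁-apart)) ⟨
  count (firstE? A B) * count (restE? A B) ∎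
  where
  open ≡-Reasoning
  open Factorisation (A zero) (B zero) (A∩B=∅ zero)
  #rest∩E₁ #E₁ : ℕ
  #rest∩E₁ = count (λ Π → restE? A B Π ×-dec similar? Π (A zero) (B zero))
  #E₁      = count (λ Π → yes tt ×-dec similar? Π (A zero) (B zero))
  all≡rest∩E₁ : count (allE? A B) ≡ #rest∩E₁
  all≡rest∩E₁ = count-cong (allE? A B) (λ Π → restE? A B Π ×-dec similar? Π (A zero) (B zero))
    (λ all → (λ i _ → all i) , all zero)
    (λ (rest , e₁) → λ { zero → e₁ ; (suc i) → rest (suc i) (s≤s z≤n) })
  -- the sure event avoids A₀
  n!≡E₁·k! : numPerms n ≡ #E₁ * numPerms k
  n!≡E₁·k! = trans (numPerms≡count-⊤ n) (count-factor (λ _ → yes tt) (λ _ _ _ _ → tt))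
  first≡E₁ : count (firstE? A B) ≡ #E₁
  first≡E₁ = count-cong (firstE? A B) (λ Π → yes tt ×-dec similar? Π (A zero) (B zero))
    (λ first → tt , first zero refl)
    (λ (_ , e₁) → λ { zero _ → e₁ ; (suc i) () })
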